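{- Let $n \geq 2$ and $r \geq 0$ be integers and let $\sigma \in S_n$. The number of transitive star factorizations of $\sigma$ into $r$ factors depends only on the conjugacy class (equivalently, the cycle type) of $\sigma$ in $S_n$.
   Context: A star transposition in $S_n$ is a transposition of the form $(i\ n)$ with $1 \leq i < n$. A star factorization of $\sigma \in S_n$ into $r$ factors is a sequence $(i_1,\ldots,i_r)$ with $1 \leq i_k < n$ such that $\sigma = (i_1\ n)(i_2\ n)\cdots(i_r\ n)$. It is called transitive if the subgroup of $S_n$ generated by $(i_1\ n),\ldots,(i_r\ n)$ is all of $S_n$ (equivalently, every $i \in \{1,\ldots,n-1\}$ occurs among $i_1,\ldots,i_r$). -}

module Defs where

open import Data.Nat using (ℕ; zero; suc)
open import Data.Fin using (Fin; fromℕ; inject₁)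
open import Data.Fin.Properties using (all?; _≟_)
open import Data.Fin.Permutation using (Permutation′; transpose; id; _∘ₚ_; _≈_; _⟨$⟩ʳ_; _⟨$⟩ˡ_)
open import Data.Vec using (Vec; []; _∷_)
open import Data.Vec.Membership.Propositional using (_∈_)
import Data.Vec.Membership.DecPropositional as VecDecMem
open import Data.List using (List; []; _∷_; length; filter; concatMap; map)
open import Data.Product using (Σ; _×_; _,_)
open import Relation.Binary.PropositionalEquality using (_≡_)
open import Relation.Nullary using (Dec; _×-dec_)

-- Throughout, S_n is modelled with n = suc m, acting on Fin (suc m);
-- the distinguished point "n" is  fromℕ m  (the last element) and the
-- points 1,…,n-1 are  inject₁ i  for  i : Fin m.

star : {m : ℕ} → Fin m → Permutation′ (suc m)
star {m} i = transpose (inject₁ i) (fromℕ m)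

-- The product (i₁ n)(i₂ n)⋯(i_r n), composed as functions right-to-left:
-- (starProd (i₁ ∷ is)) x = (i₁ n) ((starProd is) x).
-- (Note: π ∘ₚ ρ applies π first.)
starProd : {m r : ℕ} → Vec (Fin m) r → Permutation′ (suc m)
starProd []       = id
starProd (i ∷ is) = starProd is ∘ₚ star i

IsStarFactorization : {m r : ℕ} → Permutation′ (suc m) → Vec (Fin m) r → Set
IsStarFactorization σ is = starProd is ≈ σ

IsTransitive : {m r : ℕ} → Vec (Fin m) r → Set
IsTransitive {m} is = (i : Fin m) → i ∈ is

IsTransitiveStarFactorization : {m r : ℕ} → Permutation′ (suc m) → Vec (Fin m) r → Set
IsTransitiveStarFactorization σ is = IsStarFactorization σ is × IsTransitive is

isTSF? : {m r : ℕ} (σ : Permutation′ (suc m)) (is : Vec (Fin m) r) →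
         Dec (IsTransitiveStarFactorization σ is)
isTSF? σ is = all? (λ x → starProd is ⟨$⟩ʳ x ≟ σ ⟨$⟩ʳ x)
              ×-dec all? (λ i → VecDecMem._∈?_ _≟_ i is)

allFinVec : (m r : ℕ) → List (Vec (Fin m) r)
allFinVec m zero    = [] ∷ []
allFinVec m (suc r) = concatMap (λ i → map (i ∷_) (allFinVec m r)) (Data.List.allFin m)
  where import Data.List

numTSF : (m r : ℕ) → Permutation′ (suc m) → ℕ
numTSF m r σ = length (filter (isTSF? σ) (allFinVec m r))

Conjugate : {n : ℕ} → Permutation′ n → Permutation′ n → Set
Conjugate {n} σ τ = Σ (Permutation′ n) λ π → ∀ x → τ ⟨$⟩ʳ x ≡ π ⟨$⟩ʳ (σ ⟨$⟩ʳ (π ⟨$⟩ˡ x))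

module Submission where

-- Write T_c(σ) for the number of words (a₁, …, a_r) of points different from c, using every
-- such point, with (a₁ c)⋯(a_r c) = σ: the transitive star factorizations with centre c;
-- numTSF is T_n.  Relabelling all points by π gives T_{π c}(π σ π⁻¹) = T_c(σ), so the
-- theorem reduces to the independence of T_c(σ) from the centre c.  For that:
--  * counting words factor by factor, the number of words over an alphabet S with centre c is
--    the r-th power of the operator h ↦ (v ↦ Σ_{a ∈ S} h((a c) v)) applied to the indicator
--    of the identity; for two centres c ≠ d these operators satisfy commutation relations
--    from which a telescoping argument gives an identity between the r-th powers
--    (power-exchange, TwoCentres);
--  * inclusion–exclusion over the points required to occur turns it into the equality of
--    the numbers of words over R ∪ {d} with centre c and over R ∪ {c} with centre d that use
--    every letter (centre-exchange), whence transitiveCount-centre.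

open import Defs
open import Data.Bool using (Bool; true; false; _∧_; _∨_; not; if_then_else_)
open import Data.Bool.Properties
  using (∧-identityʳ; ∧-zeroʳ; ∧-assoc; ∧-comm; ∨-zeroʳ; ∧-conicalˡ; ∧-conicalʳ; T-≡)
open import Data.Fin using (Fin; fromℕ; inject₁; lower₁; toℕ)
open import Data.Fin.Properties
  using (_≟_; all?; fromℕ≢inject₁; inject₁-injective; inject₁-lower₁; toℕ-injective; toℕ-fromℕ)
open import Data.Fin.Permutation using (Permutation′; _⟨$⟩ʳ_; _⟨$⟩ˡ_; inverseˡ; inverseʳ)
open import Data.Fin.Permutation.Components using (transpose; transpose-inverse)
open import Data.List using (List; []; _∷_; _++_; length; filter; filterᵇ; concatMap; allFin)
import Data.List as List
open import Data.List.Membership.Propositional using (_∈_; _∉_)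
open import Data.List.Membership.Propositional.Properties using (∈-filter⁺; ∈-filter⁻; ∈-allFin)
open import Data.List.Relation.Unary.Any using (here; there)
open import Data.Nat using (ℕ; zero; suc; _+_; _≤_)
open import Data.Nat.Properties using (+-comm; +-assoc; +-identityʳ; +-cancelʳ-≡; +-0-commutativeMonoid)
open import Algebra.Properties.CommutativeMonoid.Sum +-0-commutativeMonoid
  using (sum-syntax; sum-cong-≗; sum-replicate-zero; sum-init-last; ∑-distrib-+; ∑-comm; ∑-permute)
open import Data.Product using (_×_; _,_; proj₁; proj₂)
open import Data.Vec using (Vec; []; _∷_; map; tabulate; lookup)
open import Data.Vec.Properties
  using (map-∘; map-cong; map-id; tabulate-∘; tabulate-cong; lookup∘tabulate; tabulate∘lookup; ≡-dec)
import Data.Vec.Membership.Propositional as Vec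
import Data.Vec.Membership.DecPropositional as VecDec
open import Data.Vec.Relation.Unary.Any using (here; there)
open import Function using (_⇔_; mk⇔; Equivalence; _∘_)
open import Level using (0ℓ)
open import Relation.Nullary using (Dec; does; yes; no; contradiction; T?)
open import Relation.Nullary.Decidable using (dec-true; dec-false; does-⇔)
open import Relation.Unary using (Pred; Decidable)
open import Relation.Binary.PropositionalEquality
open ≡-Reasoning

_==_ : {n : ℕ} → Fin n → Fin n → Bool
a == b = does (a ≟ b)

guard : Bool → ℕ → ℕ
guard b x = if b then x else 0

∑-delta : ∀ {n} (d : Fin n) (f : Fin n → ℕ) → ∑[ a < n ] guard (d == a) (f a) ≡ f d
∑-delta {suc n} Fin.zero f = trans (cong (f Fin.zero +_) (sum-replicate-zero n)) (+-identityʳ _)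
∑-delta {suc n} (Fin.suc d) f = ∑-delta d (λ a → f (Fin.suc a))

guard-∑ : ∀ {n} b (f : Fin n → ℕ) → guard b (∑[ a < n ] f a) ≡ ∑[ a < n ] guard b (f a)
guard-∑ {n} true f = refl
guard-∑ {n} false f = sym (sum-replicate-zero n)

guard-+ : ∀ b x y → guard b (x + y) ≡ guard b x + guard b y
guard-+ true x y = refl
guard-+ false x y = refl

guard-comm : ∀ b b' x → guard b (guard b' x) ≡ guard b' (guard b x)
guard-comm true b' x = refl
guard-comm false true x = refl
guard-comm false false x = refl

guard-idem : ∀ b x → guard b (guard b x) ≡ guard b x
guard-idem true x = refl
guard-idem false x = refl

guard-cong : ∀ {b} {x y} → (b ≡ true → x ≡ y) → guard b x ≡ guard b y
guard-cong {true} e = e refl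
guard-cong {false} e = refl

guard-zero : ∀ b → guard b 0 ≡ 0
guard-zero true  = refl
guard-zero false = refl

⟦_⟧ : Bool → ℕ
⟦ b ⟧ = guard b 1

≡true-ext : ∀ {b b′ : Bool} → (b ≡ true → b′ ≡ true) → (b′ ≡ true → b ≡ true) → b ≡ b′
≡true-ext {false} {false} _ _ = refl
≡true-ext {false} {true}  _ f = f refl
≡true-ext {true}  {false} t _ = sym (t refl)
≡true-ext {true}  {true}  _ _ = refl

does-bool : ∀ {A : Set} (a? : Dec A) {b : Bool} → A ⇔ (b ≡ true) → does a? ≡ b
does-bool (yes a) {true}  _   = refl
does-bool (yes a) {false} A⇔b with Equivalence.to A⇔b a
... | ()
does-bool (no ¬a) {true}  A⇔b = contradiction (Equivalence.from A⇔b refl) ¬a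
does-bool (no ¬a) {false} _   = refl

guard-indicator : ∀ b x → guard b ⟦ x ⟧ ≡ ⟦ b ∧ x ⟧
guard-indicator true  x = refl
guard-indicator false x = refl

∑-swap-off-diagonal : ∀ {n} (F G : Fin n → Fin n → ℕ) → (∀ x y → x ≢ y → F x y ≡ G y x) →
  ∑[ x < n ] G x x + ∑[ x < n ] ∑[ y < n ] F x y ≡ ∑[ x < n ] F x x + ∑[ x < n ] ∑[ y < n ] G x y
∑-swap-off-diagonal {n} F G off = begin
  ∑[ x < n ] G x x + ∑[ x < n ] ∑[ y < n ] F x y
    ≡⟨ with-diagonal F (λ x → G x x) ⟨
  ∑[ x < n ] ∑[ y < n ] (F x y + guard (x == y) (G x x))
    ≡⟨ sum-cong-≗ (λ x → sum-cong-≗ (λ y → pointwise x y)) ⟩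
  ∑[ x < n ] ∑[ y < n ] (G y x + guard (x == y) (F x x))
    ≡⟨ with-diagonal (λ x y → G y x) (λ x → F x x) ⟩
  ∑[ x < n ] F x x + ∑[ x < n ] ∑[ y < n ] G y x
    ≡⟨ cong (∑[ x < n ] F x x +_) (∑-comm (λ x y → G y x)) ⟩
  ∑[ x < n ] F x x + ∑[ x < n ] ∑[ y < n ] G x y ∎
  where
  with-diagonal : ∀ (H : Fin n → Fin n → ℕ) (φ : Fin n → ℕ) →
    ∑[ x < n ] ∑[ y < n ] (H x y + guard (x == y) (φ x)) ≡ ∑[ x < n ] φ x + ∑[ x < n ] ∑[ y < n ] H x y
  with-diagonal H φ = begin
    ∑[ x < n ] ∑[ y < n ] (H x y + guard (x == y) (φ x))
      ≡⟨ sum-cong-≗ (λ x → trans (∑-distrib-+ (H x) _) (cong (∑[ y < n ] H x y +_) (∑-delta x (λ _ → φ x)))) ⟩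
    ∑[ x < n ] (∑[ y < n ] H x y + φ x)
      ≡⟨ ∑-distrib-+ (λ x → ∑[ y < n ] H x y) φ ⟩
    ∑[ x < n ] ∑[ y < n ] H x y + ∑[ x < n ] φ x
      ≡⟨ +-comm (∑[ x < n ] ∑[ y < n ] H x y) (∑[ x < n ] φ x) ⟩
    ∑[ x < n ] φ x + ∑[ x < n ] ∑[ y < n ] H x y ∎
  pointwise : ∀ x y → F x y + guard (x == y) (G x x) ≡ G y x + guard (x == y) (F x x)
  pointwise x y with x ≟ y
  ... | yes refl = +-comm (F x x) (G x x)
  ... | no  x≢y  = cong (_+ 0) (off x y x≢y)

-- A weight on X is a function X → ℕ; the counting functions
-- below are weights on tables of permutations, and appending one factor to a
-- factorization acts on them by a linear operator.  This section is pure algebra: from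
-- A = T + P, B = T + Q, Q T = T P, A T = T B and A Q = Q A one obtains
-- A^r + Q^r = B^r + P^r (power-exchange), by writing both A^r − P^r and B^r − Q^r
-- as telescoping sums Σ_{k+j=r-1} A^k T P^j = Σ_{k+j=r-1} Q^j T B^k.
Weight : Set → Set
Weight X = X → ℕ

Operator : Set → Set
Operator X = Weight X → Weight X

module _ {X : Set} where

  infixl 6 _⊕_

  _⊕_ : Weight X → Weight X → Weight X
  (h ⊕ h′) x = h x + h′ x

  𝟘 : Weight X
  𝟘 _ = 0

  Congruent : Operator X → Set
  Congruent A = ∀ {h h′} → h ≗ h′ → A h ≗ A h′

  record Linear (A : Operator X) : Set where
    field
      cong-≗   : Congruent A
      additive : ∀ h h′ → A (h ⊕ h′) ≗ A h ⊕ A h′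
      zero-fix : A 𝟘 ≗ 𝟘

  pow : Operator X → ℕ → Operator X
  pow A zero    h = h
  pow A (suc k) h = A (pow A k h)

  pow-cong : ∀ {A : Operator X} → Congruent A → ∀ k → Congruent (pow A k)
  pow-cong A-cong zero    h≗h′ = h≗h′
  pow-cong A-cong (suc k) h≗h′ = A-cong (pow-cong A-cong k h≗h′)

  intertwine : ∀ {A B Z : Operator X} → Congruent A → (∀ h → A (Z h) ≗ Z (B h)) →
               ∀ k h → pow A k (Z h) ≗ Z (pow B k h)
  intertwine A-cong AZ≗ZB zero    h x = refl
  intertwine {B = B} A-cong AZ≗ZB (suc k) h x =
    trans (A-cong (intertwine A-cong AZ≗ZB k h) x) (AZ≗ZB (pow B k h) x)

  -- antidiagonal r F = Σ_{k+j = r-1} F k j, peeling off the term with k = 0.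
  antidiagonal : ℕ → (ℕ → ℕ → Weight X) → Weight X
  antidiagonal zero    F = 𝟘
  antidiagonal (suc r) F = F 0 r ⊕ antidiagonal r (λ k j → F (suc k) j)

  antidiagonal-last : ∀ r F → antidiagonal (suc r) F ≗ antidiagonal r (λ k j → F k (suc j)) ⊕ F r 0
  antidiagonal-last zero    F x = +-comm (F 0 0 x) 0
  antidiagonal-last (suc r) F x = begin
    F 0 (suc r) x + antidiagonal (suc r) (λ k j → F (suc k) j) x
      ≡⟨ cong (F 0 (suc r) x +_) (antidiagonal-last r (λ k j → F (suc k) j) x) ⟩
    F 0 (suc r) x + (antidiagonal r (λ k j → F (suc k) (suc j)) x + F (suc r) 0 x)
      ≡⟨ +-assoc (F 0 (suc r) x) _ _ ⟨
    F 0 (suc r) x + antidiagonal r (λ k j → F (suc k) (suc j)) x + F (suc r) 0 x ∎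

  antidiagonal-cong : ∀ r {F G : ℕ → ℕ → Weight X} → (∀ k j → F k j ≗ G k j) → antidiagonal r F ≗ antidiagonal r G
  antidiagonal-cong zero    F≗G x = refl
  antidiagonal-cong (suc r) F≗G x =
    cong₂ _+_ (F≗G 0 r x) (antidiagonal-cong r (λ k j → F≗G (suc k) j) x)

  antidiagonal-linear : ∀ {A : Operator X} → Linear A → ∀ r F →
                        A (antidiagonal r F) ≗ antidiagonal r (λ k j → A (F k j))
  antidiagonal-linear A-lin zero F = Linear.zero-fix A-lin
  antidiagonal-linear {A} A-lin (suc r) F x =
    trans (Linear.additive A-lin (F 0 r) _ x)
          (cong (A (F 0 r) x +_) (antidiagonal-linear A-lin r (λ k j → F (suc k) j) x))

  telescopeˡ : ∀ {A T P : Operator X} → Linear A → (∀ h → A h ≗ T h ⊕ P h) → ∀ r h →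
               pow A r h ≗ pow P r h ⊕ antidiagonal r (λ k j → pow A k (T (pow P j h)))
  telescopeˡ A-lin split zero h x = sym (+-identityʳ (h x))
  telescopeˡ {A} {T} {P} A-lin split (suc r) h x = begin
    A (pow A r h) x
      ≡⟨ Linear.cong-≗ A-lin (telescopeˡ A-lin split r h) x ⟩
    A (pow P r h ⊕ D) x
      ≡⟨ Linear.additive A-lin (pow P r h) D x ⟩
    A (pow P r h) x + A D x
      ≡⟨ cong₂ _+_ (split (pow P r h) x) (antidiagonal-linear A-lin r _ x) ⟩
    T (pow P r h) x + pow P (suc r) h x + antidiagonal r (λ k j → pow A (suc k) (T (pow P j h))) x
      ≡⟨ cong (_+ D′ x) (+-comm (T (pow P r h) x) _) ⟩
    pow P (suc r) h x + T (pow P r h) x + antidiagonal r (λ k j → pow A (suc k) (T (pow P j h))) x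
      ≡⟨ +-assoc (pow P (suc r) h x) _ _ ⟩
    pow P (suc r) h x + antidiagonal (suc r) (λ k j → pow A k (T (pow P j h))) x ∎
    where
    D  = antidiagonal r (λ k j → pow A k (T (pow P j h)))
    D′ = antidiagonal r (λ k j → pow A (suc k) (T (pow P j h)))

  telescopeʳ : ∀ {B T Q : Operator X} → Linear Q → (∀ h → B h ≗ T h ⊕ Q h) → ∀ r h →
               pow B r h ≗ pow Q r h ⊕ antidiagonal r (λ k j → pow Q j (T (pow B k h)))
  telescopeʳ Q-lin split zero h x = sym (+-identityʳ (h x))
  telescopeʳ {B} {T} {Q} Q-lin split (suc r) h x = begin
    B (pow B r h) x
      ≡⟨ split (pow B r h) x ⟩
    T (pow B r h) x + Q (pow B r h) x
      ≡⟨ cong (T (pow B r h) x +_) (Linear.cong-≗ Q-lin (telescopeʳ Q-lin split r h) x) ⟩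
    T (pow B r h) x + Q (pow Q r h ⊕ E) x
      ≡⟨ cong (T (pow B r h) x +_) (Linear.additive Q-lin (pow Q r h) E x) ⟩
    T (pow B r h) x + (pow Q (suc r) h x + Q E x)
      ≡⟨ cong (λ y → T (pow B r h) x + (pow Q (suc r) h x + y)) (antidiagonal-linear Q-lin r _ x) ⟩
    T (pow B r h) x + (pow Q (suc r) h x + E′ x)
      ≡⟨ +-comm (T (pow B r h) x) _ ⟩
    pow Q (suc r) h x + E′ x + T (pow B r h) x
      ≡⟨ +-assoc (pow Q (suc r) h x) _ _ ⟩
    pow Q (suc r) h x + (E′ x + T (pow B r h) x)
      ≡⟨ cong (pow Q (suc r) h x +_) (antidiagonal-last r (λ k j → pow Q j (T (pow B k h))) x) ⟨
    pow Q (suc r) h x + antidiagonal (suc r) (λ k j → pow Q j (T (pow B k h))) x ∎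
    where
    E  = antidiagonal r (λ k j → pow Q j (T (pow B k h)))
    E′ = antidiagonal r (λ k j → pow Q (suc j) (T (pow B k h)))

  -- The two telescoping sums agree summand by summand, so A^r − P^r = B^r − Q^r.
  power-exchange : ∀ {A B T P Q : Operator X} → Linear A → Linear Q →
                   (∀ h → A h ≗ T h ⊕ P h) → (∀ h → B h ≗ T h ⊕ Q h) →
                   (∀ h → Q (T h) ≗ T (P h)) → (∀ h → A (T h) ≗ T (B h)) → (∀ h → A (Q h) ≗ Q (A h)) →
                   ∀ r h → pow A r h ⊕ pow Q r h ≗ pow B r h ⊕ pow P r h
  power-exchange {A} {B} {T} {P} {Q} A-lin Q-lin splitA splitB QT≗TP AT≗TB AQ≗QA r h x = begin
    pow A r h x + pow Q r h x
      ≡⟨ cong (_+ pow Q r h x) (telescopeˡ {A} {T} {P} A-lin splitA r h x) ⟩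
    pow P r h x + D x + pow Q r h x
      ≡⟨ cong (λ y → pow P r h x + y + pow Q r h x) (antidiagonal-cong r termwise x) ⟩
    pow P r h x + E x + pow Q r h x
      ≡⟨ +-comm (pow P r h x + E x) _ ⟩
    pow Q r h x + (pow P r h x + E x)
      ≡⟨ cong (pow Q r h x +_) (+-comm (pow P r h x) (E x)) ⟩
    pow Q r h x + (E x + pow P r h x)
      ≡⟨ +-assoc (pow Q r h x) (E x) _ ⟨
    pow Q r h x + E x + pow P r h x
      ≡⟨ cong (_+ pow P r h x) (telescopeʳ {B} {T} {Q} Q-lin splitB r h x) ⟨
    pow B r h x + pow P r h x ∎
    where
    A-cong = Linear.cong-≗ A-lin
    Q-cong = Linear.cong-≗ Q-lin
    D = antidiagonal r (λ k j → pow A k (T (pow P j h)))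
    E = antidiagonal r (λ k j → pow Q j (T (pow B k h)))
    powers-commute : ∀ k j h → pow Q j (pow A k h) ≗ pow A k (pow Q j h)
    powers-commute k = intertwine {Q} {Q} {pow A k} Q-cong (λ h y → sym (intertwine {A} {A} {Q} A-cong AQ≗QA k h y))
    -- A^k T P^j = A^k Q^j T = Q^j A^k T = Q^j T B^k.
    termwise : ∀ k j → pow A k (T (pow P j h)) ≗ pow Q j (T (pow B k h))
    termwise k j y = begin
      pow A k (T (pow P j h)) y  ≡⟨ pow-cong A-cong k (λ z → sym (intertwine {Q} {P} {T} Q-cong QT≗TP j h z)) y ⟩
      pow A k (pow Q j (T h)) y  ≡⟨ powers-commute k j (T h) y ⟨
      pow Q j (pow A k (T h)) y  ≡⟨ pow-cong Q-cong j (intertwine {A} {B} {T} A-cong AT≗TB k h) y ⟩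
      pow Q j (T (pow B k h)) y  ∎

-- All commutation relations needed later follow from the
-- naturality of transpositions under relabelling (transpose-natural).
module _ {n : ℕ} where

  transpose-at-i : (i j : Fin n) → transpose i j i ≡ j
  transpose-at-i i j rewrite dec-true (i ≟ i) refl = refl

  transpose-at-j : (i j : Fin n) → transpose i j j ≡ i
  transpose-at-j i j with j ≟ i
  ... | yes j≡i = j≡i
  ... | no  _   rewrite dec-true (j ≟ j) refl = refl

  transpose-elsewhere : {i j k : Fin n} → k ≢ i → k ≢ j → transpose i j k ≡ k
  transpose-elsewhere {i} {j} {k} k≢i k≢j
    rewrite dec-false (k ≟ i) k≢i | dec-false (k ≟ j) k≢j = refl

  transpose-sym : (i j k : Fin n) → transpose i j k ≡ transpose j i k
  transpose-sym i j k = by-cases k (k ≟ i) (k ≟ j)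
    where
    by-cases : ∀ k → Dec (k ≡ i) → Dec (k ≡ j) → transpose i j k ≡ transpose j i k
    by-cases k (yes refl) _        = trans (transpose-at-i k j) (sym (transpose-at-j j k))
    by-cases k (no _)     (yes refl) = trans (transpose-at-j i k) (sym (transpose-at-i k i))
    by-cases k (no k≢i)   (no k≢j) =
      trans (transpose-elsewhere k≢i k≢j) (sym (transpose-elsewhere k≢j k≢i))

  transpose-involutive : (i j k : Fin n) → transpose i j (transpose i j k) ≡ k
  transpose-involutive i j k = trans (cong (transpose i j) (transpose-sym i j k)) (transpose-inverse i j)

  transpose-injective : (i j : Fin n) {x y : Fin n} → transpose i j x ≡ transpose i j y → x ≡ y
  transpose-injective i j {x} {y} eq =
    trans (sym (transpose-involutive i j x)) (trans (cong (transpose i j) eq) (transpose-involutive i j y))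

  transpose-natural : (ρ : Fin n → Fin n) → (∀ {x y} → ρ x ≡ ρ y → x ≡ y) →
                      ∀ i j k → ρ (transpose i j k) ≡ transpose (ρ i) (ρ j) (ρ k)
  transpose-natural ρ ρ-inj i j k = by-cases k (k ≟ i) (k ≟ j)
    where
    by-cases : ∀ k → Dec (k ≡ i) → Dec (k ≡ j) → ρ (transpose i j k) ≡ transpose (ρ i) (ρ j) (ρ k)
    by-cases k (yes refl) _          = trans (cong ρ (transpose-at-i k j)) (sym (transpose-at-i (ρ k) (ρ j)))
    by-cases k (no _)     (yes refl) = trans (cong ρ (transpose-at-j i k)) (sym (transpose-at-j (ρ i) (ρ k)))
    by-cases k (no k≢i)   (no k≢j)   = trans (cong ρ (transpose-elsewhere k≢i k≢j))
      (sym (transpose-elsewhere (λ e → k≢i (ρ-inj e)) (λ e → k≢j (ρ-inj e))))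

  conjugate-transpose : (a b i j i′ j′ : Fin n) → transpose a b i ≡ i′ → transpose a b j ≡ j′ →
                        ∀ k → transpose a b (transpose i j k) ≡ transpose i′ j′ (transpose a b k)
  conjugate-transpose a b i j i′ j′ refl refl = transpose-natural (transpose a b) (transpose-injective a b) i j

-- A map Fin N → Fin N is represented by its table of
-- values, so that equality of permutations is decidable and propositional, and a weight
-- of a table can be evaluated after composing with a transposition.
Table : ℕ → Set
Table N = Vec (Fin N) N

table : {N : ℕ} → (Fin N → Fin N) → Table N
table = tabulate

_=ᵀ_ : {N : ℕ} → Table N → Table N → Bool
u =ᵀ v = does (≡-dec _≟_ u v)

-- An alphabet: the set of points allowed as leaves of star transpositions.
Letters : ℕ → Set
Letters N = Fin N → Bool

insert : {N : ℕ} → Fin N → Letters N → Letters N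
insert d S a = (d == a) ∨ S a

delete : {N : ℕ} → Fin N → Letters N → Letters N
delete q S a = S a ∧ not (q == a)

map-interchange : ∀ {N} {f g f′ g′ : Fin N → Fin N} → (∀ k → f (g k) ≡ f′ (g′ k)) →
                  ∀ {r} (v : Vec (Fin N) r) → map f (map g v) ≡ map f′ (map g′ v)
map-interchange {f = f} {g} {f′} {g′} fg≗f′g′ v =
  trans (sym (map-∘ f g v)) (trans (map-cong fg≗f′g′ v) (map-∘ f′ g′ v))

module _ {N : ℕ} where

  -- Prepending a factor (a c) with a ∈ S:  (step c S h) v = Σ_{a ∈ S} h ((a c) v).
  -- Its r-th power applied to the indicator of the identity counts the words of length r.
  step : Fin N → Letters N → Operator (Table N)
  step c S h v = ∑[ a < N ] guard (S a) (h (map (transpose a c) v))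

  step-linear : ∀ c S → Linear (step c S)
  step-linear c S = record
    { cong-≗   = λ h≗h′ v → sum-cong-≗ (λ a → cong (guard (S a)) (h≗h′ _))
    ; additive = λ h h′ v → trans (sum-cong-≗ (λ a → guard-+ (S a) _ _))
                                 (∑-distrib-+ (λ a → guard (S a) (h (map (transpose a c) v)))
                                              (λ a → guard (S a) (h′ (map (transpose a c) v))))
    ; zero-fix = λ v → trans (sum-cong-≗ (λ a → guard-zero (S a))) (sum-replicate-zero N)
    }

  step-insert : ∀ c d S → S d ≡ false → ∀ h v →
                step c (insert d S) h v ≡ h (map (transpose d c) v) + step c S h v
  step-insert c d S Sd h v = begin
    ∑[ a < N ] guard ((d == a) ∨ S a) (f a)
      ≡⟨ sum-cong-≗ split ⟩
    ∑[ a < N ] (guard (d == a) (f a) + guard (S a) (f a))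
      ≡⟨ ∑-distrib-+ (λ a → guard (d == a) (f a)) (λ a → guard (S a) (f a)) ⟩
    ∑[ a < N ] guard (d == a) (f a) + step c S h v
      ≡⟨ cong (_+ step c S h v) (∑-delta d f) ⟩
    f d + step c S h v ∎
    where
    f : Fin N → ℕ
    f a = h (map (transpose a c) v)
    split : ∀ a → guard ((d == a) ∨ S a) (f a) ≡ guard (d == a) (f a) + guard (S a) (f a)
    split a with d ≟ a
    ... | yes refl rewrite Sd = sym (+-identityʳ (f d))
    ... | no  _    = refl

-- With t = (d c),
--   A = step c (R ∪ {d}),  P = step c R,  B = step d (R ∪ {c}),  Q = step d R,  T h v = h (t v),
-- these operators satisfy the hypotheses of power-exchange.
module TwoCentres {N : ℕ} {c d : Fin N} (c≢d : c ≢ d) (R : Letters N) (Rc : R c ≡ false) (Rd : R d ≡ false) where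

  T A P B Q : Operator (Table N)
  T h v = h (map (transpose d c) v)
  A = step c (insert d R)
  P = step c R
  B = step d (insert c R)
  Q = step d R

  off-centres : ∀ {a} → R a ≡ true → a ≢ c × a ≢ d
  off-centres Ra = (λ { refl → contradiction (trans (sym Ra) Rc) λ () })
                 , (λ { refl → contradiction (trans (sym Ra) Rd) λ () })

  splitA : ∀ h → A h ≗ T h ⊕ P h
  splitA = step-insert c d R Rd

  splitB : ∀ h → B h ≗ T h ⊕ Q h
  splitB h v = trans (step-insert d c R Rc h v) (cong (λ u → h u + Q h v) (map-cong (transpose-sym c d) v))

  -- Q T = T P and A T = T B: conjugation by t exchanges the centres, (d c)(a d) = (a c)(d c).
  Q-T : ∀ h → Q (T h) ≗ T (P h)
  Q-T h v = sum-cong-≗ λ a → guard-cong λ Ra →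
    let (a≢c , a≢d) = off-centres Ra in
    cong h (map-interchange (conjugate-transpose d c a d a c
                               (transpose-elsewhere a≢d a≢c) (transpose-at-i d c)) v)

  A-T : ∀ h → A (T h) ≗ T (B h)
  A-T h v = begin
    A (T h) v                              ≡⟨ splitA (T h) v ⟩
    T (T h) v + P (T h) v                  ≡⟨ cong (T (T h) v +_) P-T ⟩
    T h (map t v) + Q h (map t v)          ≡⟨ splitB h (map t v) ⟨
    T (B h) v                              ∎
    where
    t = transpose d c
    P-T : P (T h) v ≡ Q h (map t v)
    P-T = sum-cong-≗ λ a → guard-cong λ Ra →
      let (a≢c , a≢d) = off-centres Ra in
      cong h (map-interchange (conjugate-transpose d c a c a d
                                 (transpose-elsewhere a≢d a≢c) (transpose-at-j d c)) v)

  -- Expanding A = T + P it remains to see T Q + P Q = Q T + Q P: the double sums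
  -- P Q and Q P agree off the diagonal (disjoint transpositions commute), and each diagonal
  -- matches the single sum on the other side via (x c)(x d) = (x d)(d c) and
  -- (x d)(x c) = (d c)(x d).
  A-Q : ∀ h → A (Q h) ≗ Q (A h)
  A-Q h v = begin
    A (Q h) v                                              ≡⟨ splitA (Q h) v ⟩
    T (Q h) v + P (Q h) v                                  ≡⟨ cong₂ _+_ (sum-cong-≗ G-diagonal) P-Q ⟩
    ∑[ x < N ] G x x + ∑[ x < N ] ∑[ y < N ] F x y      ≡⟨ ∑-swap-off-diagonal F G off-diagonal ⟩
    ∑[ x < N ] F x x + ∑[ x < N ] ∑[ y < N ] G x y      ≡⟨ cong₂ _+_ (sum-cong-≗ F-diagonal) Q-P ⟨
    Q (T h) v + Q (P h) v                                  ≡⟨ Linear.additive (step-linear d R) (T h) (P h) v ⟨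
    Q (T h ⊕ P h) v                                        ≡⟨ Linear.cong-≗ (step-linear d R) (splitA h) v ⟨
    Q (A h) v                                              ∎
    where
    t : Fin N → Fin N
    t = transpose d c
    F G : Fin N → Fin N → ℕ
    F x y = guard (R x) (guard (R y) (h (map (transpose y d) (map (transpose x c) v))))
    G y x = guard (R y) (guard (R x) (h (map (transpose x c) (map (transpose y d) v))))
    P-Q : P (Q h) v ≡ ∑[ x < N ] ∑[ y < N ] F x y
    P-Q = sum-cong-≗ λ x → guard-∑ (R x) (λ y → guard (R y) (h (map (transpose y d) (map (transpose x c) v))))
    Q-P : Q (P h) v ≡ ∑[ y < N ] ∑[ x < N ] G y x
    Q-P = sum-cong-≗ λ y → guard-∑ (R y) (λ x → guard (R x) (h (map (transpose x c) (map (transpose y d) v))))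
    -- Off the diagonal the transpositions (x c) and (y d) are disjoint, hence commute.
    off-diagonal : ∀ x y → x ≢ y → F x y ≡ G y x
    off-diagonal x y x≢y = trans (guard-comm (R x) (R y) _) (guard-cong λ Ry → guard-cong λ Rx →
      let x≢d = proj₂ (off-centres Rx) ; y≢c = proj₁ (off-centres Ry) in
      cong h (map-interchange (conjugate-transpose y d x c x c
        (transpose-elsewhere x≢y x≢d) (transpose-elsewhere (y≢c ∘ sym) c≢d)) v))
    -- (x c)(x d) = (x d)(d c): the diagonal of Q P is the summand of T Q.
    G-diagonal : ∀ x → guard (R x) (h (map (transpose x d) (map t v))) ≡ G x x
    G-diagonal x = sym (trans (guard-idem (R x) _) (guard-cong λ Rx →
      let x≢c = proj₁ (off-centres Rx) in
      cong h (sym (map-interchange (conjugate-transpose x d d c x c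
        (transpose-at-j x d) (transpose-elsewhere (x≢c ∘ sym) c≢d)) v))))
    -- (x d)(x c) = (d c)(x d): the diagonal of P Q is the summand of Q T.
    F-diagonal : ∀ x → guard (R x) (h (map t (map (transpose x d) v))) ≡ F x x
    F-diagonal x = sym (trans (guard-idem (R x) _) (guard-cong λ Rx →
      let x≢c = proj₁ (off-centres Rx) in
      cong h (map-interchange (conjugate-transpose x d x c d c
        (transpose-at-i x d) (transpose-elsewhere (x≢c ∘ sym) c≢d)) v)))

  power-identity : ∀ r h → pow A r h ⊕ pow Q r h ≗ pow B r h ⊕ pow P r h
  power-identity = power-exchange (step-linear c (insert d R)) (step-linear d R) splitA splitB Q-T A-T A-Q

module _ {N : ℕ} where

  map-transpose-involutive : ∀ (i j : Fin N) {r} (u : Vec (Fin N) r) →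
                             map (transpose i j) (map (transpose i j) u) ≡ u
  map-transpose-involutive i j u =
    trans (sym (map-∘ (transpose i j) (transpose i j) u)) (trans (map-cong (transpose-involutive i j) u) (map-id u))

  -- (a c) f has table v iff f has table (a c) v, since (a c) is an involution.
  table-step : ∀ a c (f : Fin N → Fin N) v →
               (table (λ x → transpose a c (f x)) =ᵀ v) ≡ (table f =ᵀ map (transpose a c) v)
  table-step a c f v = trans (cong (_=ᵀ v) (tabulate-∘ (transpose a c) f))
                             (does-⇔ (mk⇔ to from) (≡-dec _≟_ _ v) (≡-dec _≟_ (table f) _))
    where
    to : map (transpose a c) (table f) ≡ v → table f ≡ map (transpose a c) v
    to eq = trans (sym (map-transpose-involutive a c (table f))) (cong (map (transpose a c)) eq)
    from : table f ≡ map (transpose a c) v → map (transpose a c) (table f) ≡ v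
    from eq = trans (cong (map (transpose a c)) eq) (map-transpose-involutive a c v)

  starProduct : ∀ {r} → Fin N → Vec (Fin N) r → Fin N → Fin N
  starProduct c []      x = x
  starProduct c (a ∷ w) x = transpose a c (starProduct c w x)

  occurs : ∀ {r} → Fin N → Vec (Fin N) r → Bool
  occurs q []      = false
  occurs q (a ∷ w) = (q == a) ∨ occurs q w

  allIn : ∀ {r} → Letters N → Vec (Fin N) r → Bool
  allIn S []      = true
  allIn S (a ∷ w) = S a ∧ allIn S w

  covers : ∀ {r} → List (Fin N) → Vec (Fin N) r → Bool
  covers []      w = true
  covers (q ∷ Q) w = occurs q w ∧ covers Q w

module _ {n : ℕ} where

  ∑W : (r : ℕ) → (Vec (Fin n) r → ℕ) → ℕ
  ∑W zero    g = g []
  ∑W (suc r) g = ∑[ a < n ] ∑W r (λ w → g (a ∷ w))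

  ∑W-cong : ∀ r {g g′ : Vec (Fin n) r → ℕ} → (∀ w → g w ≡ g′ w) → ∑W r g ≡ ∑W r g′
  ∑W-cong zero    g≗g′ = g≗g′ []
  ∑W-cong (suc r) g≗g′ = sum-cong-≗ λ a → ∑W-cong r (λ w → g≗g′ (a ∷ w))

  ∑W-distrib : ∀ r (g g′ : Vec (Fin n) r → ℕ) → ∑W r (λ w → g w + g′ w) ≡ ∑W r g + ∑W r g′
  ∑W-distrib zero    g g′ = refl
  ∑W-distrib (suc r) g g′ = trans (sum-cong-≗ λ a → ∑W-distrib r (λ w → g (a ∷ w)) (λ w → g′ (a ∷ w)))
                                  (∑-distrib-+ (λ a → ∑W r (λ w → g (a ∷ w))) (λ a → ∑W r (λ w → g′ (a ∷ w))))

  ∑W-guard : ∀ r b (g : Vec (Fin n) r → ℕ) → ∑W r (λ w → guard b (g w)) ≡ guard b (∑W r g)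
  ∑W-guard zero    b g = refl
  ∑W-guard (suc r) b g = trans (sum-cong-≗ λ a → ∑W-guard r b (λ w → g (a ∷ w)))
                               (sym (guard-∑ b (λ a → ∑W r (λ w → g (a ∷ w)))))

  ∑W-permute : ∀ r (π : Permutation′ n) (g : Vec (Fin n) r → ℕ) →
               ∑W r g ≡ ∑W r (λ w → g (map (π ⟨$⟩ʳ_) w))
  ∑W-permute zero    π g = refl
  ∑W-permute (suc r) π g = begin
    ∑[ a < n ] ∑W r (λ w → g (a ∷ w))
      ≡⟨ sum-cong-≗ (λ a → ∑W-permute r π (λ w → g (a ∷ w))) ⟩
    ∑[ a < n ] ∑W r (λ w → g (a ∷ map (π ⟨$⟩ʳ_) w))
      ≡⟨ ∑-permute (λ a → ∑W r (λ w → g (a ∷ map (π ⟨$⟩ʳ_) w))) π ⟩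
    ∑[ b < n ] ∑W r (λ w → g ((π ⟨$⟩ʳ b) ∷ map (π ⟨$⟩ʳ_) w)) ∎

module _ {N : ℕ} where

  starCount : Fin N → Letters N → List (Fin N) → (r : ℕ) → Weight (Table N)
  starCount c S Q r v = ∑W r (λ w → ⟦ allIn S w ∧ covers Q w ∧ (table (starProduct c w) =ᵀ v) ⟧)

  allIn-cong : ∀ {S S′} → (∀ a → S a ≡ S′ a) → ∀ {r} (w : Vec (Fin N) r) → allIn S w ≡ allIn S′ w
  allIn-cong S≗S′ []      = refl
  allIn-cong S≗S′ (a ∷ w) = cong₂ _∧_ (S≗S′ a) (allIn-cong S≗S′ w)

  starCount-letters : ∀ c {S S′} → (∀ a → S a ≡ S′ a) → ∀ Q r v → starCount c S Q r v ≡ starCount c S′ Q r v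
  starCount-letters c S≗S′ Q r v = ∑W-cong r λ w →
    cong (λ b → ⟦ b ∧ covers Q w ∧ (table (starProduct c w) =ᵀ v) ⟧) (allIn-cong S≗S′ w)

  starCount-covers : ∀ c S Q Q′ → (∀ {s} (w : Vec (Fin N) s) → covers Q w ≡ covers Q′ w) →
                     ∀ r v → starCount c S Q r v ≡ starCount c S Q′ r v
  starCount-covers c S Q Q′ Q≈Q′ r v = ∑W-cong r λ w →
    cong (λ b → ⟦ allIn S w ∧ b ∧ (table (starProduct c w) =ᵀ v) ⟧) (Q≈Q′ w)

  allIn-delete : ∀ q S {r} (w : Vec (Fin N) r) → allIn (delete q S) w ≡ allIn S w ∧ not (occurs q w)
  allIn-delete q S []      = refl
  allIn-delete q S (a ∷ w) with S a | q == a
  ... | false | _     = refl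
  ... | true  | true  = sym (∧-zeroʳ (allIn S w))
  ... | true  | false = allIn-delete q S w

  -- Inclusion–exclusion on one point q: words covering Q either contain q or are words over S ∖ {q}.
  exclusion : ∀ c S q Q r v → starCount c S Q r v ≡ starCount c S (q ∷ Q) r v + starCount c (delete q S) Q r v
  exclusion c S q Q r v = trans (∑W-cong r split) (∑W-distrib r _ _)
    where
    split-on : ∀ a o C e → ⟦ a ∧ C ∧ e ⟧ ≡ ⟦ a ∧ (o ∧ C) ∧ e ⟧ + ⟦ (a ∧ not o) ∧ C ∧ e ⟧
    split-on false o     C e = refl
    split-on true  true  C e = sym (+-identityʳ ⟦ C ∧ e ⟧)
    split-on true  false C e = refl
    split : ∀ w → ⟦ allIn S w ∧ covers Q w ∧ (table (starProduct c w) =ᵀ v) ⟧ ≡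
                  ⟦ allIn S w ∧ covers (q ∷ Q) w ∧ (table (starProduct c w) =ᵀ v) ⟧ +
                  ⟦ allIn (delete q S) w ∧ covers Q w ∧ (table (starProduct c w) =ᵀ v) ⟧
    split w rewrite allIn-delete q S w =
      split-on (allIn S w) (occurs q w) (covers Q w) (table (starProduct c w) =ᵀ v)

  starCount-first-factor : ∀ c S r v → starCount c S [] (suc r) v ≡ step c S (starCount c S [] r) v
  starCount-first-factor c S r v = sum-cong-≗ λ a →
    trans (∑W-cong r (first-letter a)) (∑W-guard r (S a) _)
    where
    first-letter : ∀ a w → ⟦ (S a ∧ allIn S w) ∧ true ∧ (table (starProduct c (a ∷ w)) =ᵀ v) ⟧ ≡
                           guard (S a) ⟦ allIn S w ∧ true ∧ (table (starProduct c w) =ᵀ map (transpose a c) v) ⟧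
    first-letter a w rewrite table-step a c (starProduct c w) v with S a
    ... | true  = refl
    ... | false = refl

  atIdentity : Weight (Table N)
  atIdentity v = ⟦ table (λ x → x) =ᵀ v ⟧

  starCount-as-power : ∀ c S r → starCount c S [] r ≗ pow (step c S) r atIdentity
  starCount-as-power c S zero    v = refl
  starCount-as-power c S (suc r) v =
    trans (starCount-first-factor c S r v) (Linear.cong-≗ (step-linear c S) (starCount-as-power c S r) v)

  word-count-exchange : ∀ {c d : Fin N} → c ≢ d → ∀ R → R c ≡ false → R d ≡ false → ∀ r v →
                        starCount c (insert d R) [] r v + starCount d R [] r v ≡
                        starCount d (insert c R) [] r v + starCount c R [] r v
  word-count-exchange {c} {d} c≢d R Rc Rd r v = begin
    starCount c (insert d R) [] r v + starCount d R [] r v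
      ≡⟨ cong₂ _+_ (starCount-as-power c (insert d R) r v) (starCount-as-power d R r v) ⟩
    pow (step c (insert d R)) r atIdentity v + pow (step d R) r atIdentity v
      ≡⟨ TwoCentres.power-identity c≢d R Rc Rd r atIdentity v ⟩
    pow (step d (insert c R)) r atIdentity v + pow (step c R) r atIdentity v
      ≡⟨ cong₂ _+_ (starCount-as-power d (insert c R) r v) (starCount-as-power c R r v) ⟨
    starCount d (insert c R) [] r v + starCount c R [] r v ∎

  delete-insert : ∀ (d : Fin N) R → R d ≡ false → ∀ a → delete d (insert d R) a ≡ R a
  delete-insert d R Rd a with d ≟ a
  ... | yes refl = sym Rd
  ... | no  _    = ∧-identityʳ (R a)

  delete-insert-comm : ∀ {q d : Fin N} → q ≢ d → ∀ R a → delete q (insert d R) a ≡ insert d (delete q R) a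
  delete-insert-comm {q} {d} q≢d R a with d ≟ a
  ... | yes refl rewrite dec-false (q ≟ d) q≢d = refl
  ... | no  _    = refl

  covers-swap : ∀ (q d : Fin N) Q {s} (w : Vec (Fin N) s) → covers (q ∷ d ∷ Q) w ≡ covers (d ∷ q ∷ Q) w
  covers-swap q d Q w =
    trans (sym (∧-assoc (occurs q w) (occurs d w) (covers Q w)))
          (trans (cong (_∧ covers Q w) (∧-comm (occurs q w) (occurs d w)))
                 (∧-assoc (occurs d w) (occurs q w) (covers Q w)))

  split-on-letter : ∀ (c d : Fin N) R → R d ≡ false → ∀ r v →
                    starCount c (insert d R) [] r v ≡ starCount c (insert d R) (d ∷ []) r v + starCount c R [] r v
  split-on-letter c d R Rd r v =
    trans (exclusion c (insert d R) d [] r v)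
          (cong (starCount c (insert d R) (d ∷ []) r v +_) (starCount-letters c (delete-insert d R Rd) [] r v))

  transfer-base : ∀ {c d : Fin N} → c ≢ d → ∀ R → R c ≡ false → R d ≡ false → ∀ r v →
                  starCount c (insert d R) (d ∷ []) r v ≡ starCount d (insert c R) (c ∷ []) r v
  transfer-base {c} {d} c≢d R Rc Rd r v = +-cancelʳ-≡ (Pc + Qd) Hc Hd (begin
    Hc + (Pc + Qd)                          ≡⟨ +-assoc Hc Pc Qd ⟨
    Hc + Pc + Qd                            ≡⟨ cong (_+ Qd) (split-on-letter c d R Rd r v) ⟨
    starCount c (insert d R) [] r v + Qd    ≡⟨ word-count-exchange c≢d R Rc Rd r v ⟩
    starCount d (insert c R) [] r v + Pc    ≡⟨ cong (_+ Pc) (split-on-letter d c R Rc r v) ⟩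
    Hd + Qd + Pc                            ≡⟨ +-assoc Hd Qd Pc ⟩
    Hd + (Qd + Pc)                          ≡⟨ cong (Hd +_) (+-comm Qd Pc) ⟩
    Hd + (Pc + Qd)                          ∎)
    where
    Hc = starCount c (insert d R) (d ∷ []) r v
    Hd = starCount d (insert c R) (c ∷ []) r v
    Pc = starCount c R [] r v
    Qd = starCount d R [] r v

  transfer-split : ∀ (c : Fin N) {d q} → q ≢ d → ∀ R Q r v →
                   starCount c (insert d R) (d ∷ Q) r v ≡
                   starCount c (insert d R) (d ∷ q ∷ Q) r v + starCount c (insert d (delete q R)) (d ∷ Q) r v
  transfer-split c {d} {q} q≢d R Q r v =
    trans (exclusion c (insert d R) q (d ∷ Q) r v)
          (cong₂ _+_ (starCount-covers c (insert d R) (q ∷ d ∷ Q) (d ∷ q ∷ Q) (covers-swap q d Q) r v)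
                     (starCount-letters c (delete-insert-comm q≢d R) (d ∷ Q) r v))

  -- The base case extended by induction on the list Q of further points that must occur,
  -- removing one point of Q at a time from the alphabet (exclusion).
  transfer : ∀ {c d : Fin N} → c ≢ d → ∀ Q → c ∉ Q → d ∉ Q → ∀ R → R c ≡ false → R d ≡ false → ∀ r v →
             starCount c (insert d R) (d ∷ Q) r v ≡ starCount d (insert c R) (c ∷ Q) r v
  transfer c≢d []      _   _   R Rc Rd r v = transfer-base c≢d R Rc Rd r v
  transfer {c} {d} c≢d (q ∷ Q) c∉qQ d∉qQ R Rc Rd r v = +-cancelʳ-≡ X₂ X₁ Y₁ (begin
    X₁ + X₂                                  ≡⟨ transfer-split c q≢d R Q r v ⟨
    starCount c (insert d R) (d ∷ Q) r v     ≡⟨ transfer c≢d Q c∉Q d∉Q R Rc Rd r v ⟩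
    starCount d (insert c R) (c ∷ Q) r v     ≡⟨ transfer-split d q≢c R Q r v ⟩
    Y₁ + Y₂                                  ≡⟨ cong (Y₁ +_) (transfer c≢d Q c∉Q d∉Q R′ R′c R′d r v) ⟨
    Y₁ + X₂                                  ∎)
    where
    q≢c : q ≢ c
    q≢c q≡c = c∉qQ (here (sym q≡c))
    q≢d : q ≢ d
    q≢d q≡d = d∉qQ (here (sym q≡d))
    c∉Q : c ∉ Q
    c∉Q = c∉qQ ∘ there
    d∉Q : d ∉ Q
    d∉Q = d∉qQ ∘ there
    R′ = delete q R
    R′c : R′ c ≡ false
    R′c = cong (_∧ not (q == c)) Rc
    R′d : R′ d ≡ false
    R′d = cong (_∧ not (q == d)) Rd
    X₁ = starCount c (insert d R) (d ∷ q ∷ Q) r v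
    X₂ = starCount c (insert d R′) (d ∷ Q) r v
    Y₁ = starCount d (insert c R) (c ∷ q ∷ Q) r v
    Y₂ = starCount d (insert c R′) (c ∷ Q) r v

module _ {N : ℕ} where

  elements : Letters N → List (Fin N)
  elements S = filterᵇ S (allFin N)

  ∈-elements : ∀ {S z} → z ∈ elements S ⇔ S z ≡ true
  ∈-elements {S} {z} = mk⇔
    (λ z∈ → Equivalence.to T-≡ (proj₂ (∈-filter⁻ (T? ∘ S) {xs = allFin N} z∈)))
    (λ Sz → ∈-filter⁺ (T? ∘ S) (∈-allFin z) (Equivalence.from T-≡ Sz))

  covers-true : ∀ Q {r} (w : Vec (Fin N) r) → covers Q w ≡ true ⇔ (∀ q → q ∈ Q → occurs q w ≡ true)
  covers-true Q w = mk⇔ (to Q) (from Q)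
    where
    to : ∀ Q → covers Q w ≡ true → ∀ q → q ∈ Q → occurs q w ≡ true
    to (q ∷ Q) e .q (here refl) = ∧-conicalˡ (occurs q w) (covers Q w) e
    to (q ∷ Q) e p  (there p∈)  = to Q (∧-conicalʳ (occurs q w) (covers Q w) e) p p∈
    from : ∀ Q → (∀ q → q ∈ Q → occurs q w ≡ true) → covers Q w ≡ true
    from []      h = refl
    from (q ∷ Q) h = cong₂ _∧_ (h q (here refl)) (from Q (λ p p∈ → h p (there p∈)))

  covers-elements : ∀ S {r} (w : Vec (Fin N) r) →
                    covers (elements S) w ≡ true ⇔ (∀ z → S z ≡ true → occurs z w ≡ true)
  covers-elements S w = mk⇔
    (λ e z Sz → Equivalence.to (covers-true (elements S) w) e z (Equivalence.from ∈-elements Sz))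
    (λ h → Equivalence.from (covers-true (elements S) w) (λ z z∈ → h z (Equivalence.to ∈-elements z∈)))

  covers-elements-cong : ∀ {S S′} → (∀ a → S a ≡ S′ a) → ∀ {r} (w : Vec (Fin N) r) →
                         covers (elements S) w ≡ covers (elements S′) w
  covers-elements-cong {S} {S′} S≗S′ w = ≡true-ext
    (λ e → from S′ (λ z S′z → to S e z (trans (S≗S′ z) S′z)))
    (λ e → from S (λ z Sz → to S′ e z (trans (sym (S≗S′ z)) Sz)))
    where
    to   = λ S → Equivalence.to (covers-elements S w)
    from = λ S → Equivalence.from (covers-elements S w)

  -- fullCount c S: words over S using every letter of S.  For S = all points but c these are
  -- exactly the transitive star factorizations with centre c.
  fullCount : Fin N → Letters N → (r : ℕ) → Weight (Table N)
  fullCount c S = starCount c S (elements S)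

  fullCount-cong : ∀ c {S S′} → (∀ a → S a ≡ S′ a) → ∀ r v → fullCount c S r v ≡ fullCount c S′ r v
  fullCount-cong c {S} {S′} S≗S′ r v =
    trans (starCount-letters c S≗S′ (elements S) r v)
          (starCount-covers c S′ (elements S) (elements S′) (covers-elements-cong S≗S′) r v)

  covers-insert : ∀ d R {r} (w : Vec (Fin N) r) → covers (elements (insert d R)) w ≡ covers (d ∷ elements R) w
  covers-insert d R w = ≡true-ext
    (λ e → Equivalence.from (covers-true (d ∷ elements R) w) λ
      { q (here refl) → Equivalence.to (covers-elements (insert d R) w) e d insert-d
      ; q (there q∈)  → Equivalence.to (covers-elements (insert d R) w) e q
                          (trans (cong ((d == q) ∨_) (Equivalence.to ∈-elements q∈)) (∨-zeroʳ (d == q))) })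
    (λ e → Equivalence.from (covers-elements (insert d R) w) λ z dRz →
      Equivalence.to (covers-true (d ∷ elements R) w) e z (member z dRz))
    where
    insert-d : insert d R d ≡ true
    insert-d rewrite dec-true (d ≟ d) refl = refl
    member : ∀ z → insert d R z ≡ true → z ∈ d ∷ elements R
    member z dRz with d ≟ z
    ... | yes refl = here refl
    ... | no  _    = there (Equivalence.from ∈-elements dRz)

  fullCount-insert : ∀ c d R r v → fullCount c (insert d R) r v ≡ starCount c (insert d R) (d ∷ elements R) r v
  fullCount-insert c d R = starCount-covers c (insert d R) (elements (insert d R)) (d ∷ elements R) (covers-insert d R)

  centre-exchange : ∀ {c d : Fin N} → c ≢ d → ∀ R → R c ≡ false → R d ≡ false → ∀ r v →
                    fullCount c (insert d R) r v ≡ fullCount d (insert c R) r v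
  centre-exchange {c} {d} c≢d R Rc Rd r v = begin
    fullCount c (insert d R) r v                ≡⟨ fullCount-insert c d R r v ⟩
    starCount c (insert d R) (d ∷ elements R) r v ≡⟨ transfer c≢d (elements R) (∉-elements Rc) (∉-elements Rd) R Rc Rd r v ⟩
    starCount d (insert c R) (c ∷ elements R) r v ≡⟨ fullCount-insert d c R r v ⟨
    fullCount d (insert c R) r v                ∎
    where
    ∉-elements : ∀ {z} → R z ≡ false → z ∉ elements R
    ∉-elements Rz z∈ with trans (sym (Equivalence.to ∈-elements z∈)) Rz
    ... | ()

  allBut : Fin N → Letters N
  allBut c a = not (c == a)

  transitiveCount : Fin N → (r : ℕ) → Weight (Table N)
  transitiveCount c = fullCount c (allBut c)

  transitiveCount-centre : ∀ c d r v → transitiveCount c r v ≡ transitiveCount d r v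
  transitiveCount-centre c d r v with c ≟ d
  ... | yes refl = refl
  ... | no  c≢d  = begin
    fullCount c (allBut c) r v    ≡⟨ fullCount-cong c allBut-c r v ⟩
    fullCount c (insert d R) r v  ≡⟨ centre-exchange c≢d R Rc Rd r v ⟩
    fullCount d (insert c R) r v  ≡⟨ fullCount-cong d allBut-d r v ⟨
    fullCount d (allBut d) r v    ∎
    where
    R : Letters N
    R a = not (c == a) ∧ not (d == a)
    Rc : R c ≡ false
    Rc rewrite dec-true (c ≟ c) refl = refl
    Rd : R d ≡ false
    Rd rewrite dec-true (d ≟ d) refl = ∧-zeroʳ (not (c == d))
    allBut-c : ∀ a → allBut c a ≡ insert d R a
    allBut-c a with d ≟ a
    ... | yes refl rewrite dec-false (c ≟ d) c≢d = refl
    ... | no  _    = sym (∧-identityʳ (not (c == a)))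
    allBut-d : ∀ a → allBut d a ≡ insert c R a
    allBut-d a with c ≟ a
    ... | yes refl rewrite dec-false (d ≟ c) (c≢d ∘ sym) = refl
    ... | no  _    = refl

module _ {k N : ℕ} {ρ : Fin k → Fin N} (ρ-injective : ∀ {x y} → ρ x ≡ ρ y → x ≡ y) where

  ==-relabel : ∀ x y → (ρ x == ρ y) ≡ (x == y)
  ==-relabel x y = does-⇔ (mk⇔ ρ-injective (cong ρ)) (ρ x ≟ ρ y) (x ≟ y)

  occurs-relabel : ∀ q {r} (w : Vec (Fin k) r) → occurs (ρ q) (map ρ w) ≡ occurs q w
  occurs-relabel q []      = refl
  occurs-relabel q (a ∷ w) = cong₂ _∨_ (==-relabel q a) (occurs-relabel q w)

allIn-map : ∀ {k N} (S : Letters N) (ρ : Fin k → Fin N) {r} (w : Vec (Fin k) r) → allIn S (map ρ w) ≡ allIn (S ∘ ρ) w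
allIn-map S ρ []      = refl
allIn-map S ρ (a ∷ w) = cong (S (ρ a) ∧_) (allIn-map S ρ w)

module _ {N : ℕ} (π : Permutation′ N) where

  π-injective : ∀ {x y} → π ⟨$⟩ʳ x ≡ π ⟨$⟩ʳ y → x ≡ y
  π-injective e = trans (sym (inverseˡ π)) (trans (cong (π ⟨$⟩ˡ_) e) (inverseˡ π))

  conj : Table N → Table N
  conj v = table (λ x → π ⟨$⟩ʳ lookup v (π ⟨$⟩ˡ x))

  conj-injective : ∀ {u v} → conj u ≡ conj v → u ≡ v
  conj-injective {u} {v} e = trans (sym (tabulate∘lookup u)) (trans (tabulate-cong pointwise) (tabulate∘lookup v))
    where
    pointwise : ∀ y → lookup u y ≡ lookup v y
    pointwise y = π-injective (begin
      π ⟨$⟩ʳ lookup u y                    ≡⟨ cong (λ z → π ⟨$⟩ʳ lookup u z) (inverseˡ π) ⟨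
      π ⟨$⟩ʳ lookup u (π ⟨$⟩ˡ (π ⟨$⟩ʳ y))  ≡⟨ lookup∘tabulate _ (π ⟨$⟩ʳ y) ⟨
      lookup (conj u) (π ⟨$⟩ʳ y)           ≡⟨ cong (λ t → lookup t (π ⟨$⟩ʳ y)) e ⟩
      lookup (conj v) (π ⟨$⟩ʳ y)           ≡⟨ lookup∘tabulate _ (π ⟨$⟩ʳ y) ⟩
      π ⟨$⟩ʳ lookup v (π ⟨$⟩ˡ (π ⟨$⟩ʳ y))  ≡⟨ cong (λ z → π ⟨$⟩ʳ lookup v z) (inverseˡ π) ⟩
      π ⟨$⟩ʳ lookup v y                    ∎)

  starProduct-relabel : ∀ c {r} (w : Vec (Fin N) r) y →
                        starProduct (π ⟨$⟩ʳ c) (map (π ⟨$⟩ʳ_) w) (π ⟨$⟩ʳ y) ≡ π ⟨$⟩ʳ starProduct c w y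
  starProduct-relabel c []      y = refl
  starProduct-relabel c (a ∷ w) y =
    trans (cong (transpose (π ⟨$⟩ʳ a) (π ⟨$⟩ʳ c)) (starProduct-relabel c w y))
          (sym (transpose-natural (π ⟨$⟩ʳ_) π-injective a c (starProduct c w y)))

  table-relabel : ∀ c {r} (w : Vec (Fin N) r) →
                  table (starProduct (π ⟨$⟩ʳ c) (map (π ⟨$⟩ʳ_) w)) ≡ conj (table (starProduct c w))
  table-relabel c w = tabulate-cong λ x → begin
    starProduct (π ⟨$⟩ʳ c) (map (π ⟨$⟩ʳ_) w) x
      ≡⟨ cong (starProduct (π ⟨$⟩ʳ c) (map (π ⟨$⟩ʳ_) w)) (inverseʳ π) ⟨
    starProduct (π ⟨$⟩ʳ c) (map (π ⟨$⟩ʳ_) w) (π ⟨$⟩ʳ (π ⟨$⟩ˡ x))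
      ≡⟨ starProduct-relabel c w (π ⟨$⟩ˡ x) ⟩
    π ⟨$⟩ʳ starProduct c w (π ⟨$⟩ˡ x)
      ≡⟨ cong (π ⟨$⟩ʳ_) (lookup∘tabulate (starProduct c w) (π ⟨$⟩ˡ x)) ⟨
    π ⟨$⟩ʳ lookup (table (starProduct c w)) (π ⟨$⟩ˡ x) ∎

  fullCount-relabel : ∀ c S r v → fullCount (π ⟨$⟩ʳ c) (λ a → S (π ⟨$⟩ˡ a)) r (conj v) ≡ fullCount c S r v
  fullCount-relabel c S r v = trans (∑W-permute r π _) (∑W-cong r λ w →
    cong₂ (λ a b → ⟦ a ∧ b ⟧) (letters w) (cong₂ _∧_ (covering w) (target w)))
    where
    S′ : Letters N
    S′ a = S (π ⟨$⟩ˡ a)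
    letters : ∀ w → allIn S′ (map (π ⟨$⟩ʳ_) w) ≡ allIn S w
    letters w = trans (allIn-map S′ (π ⟨$⟩ʳ_) w) (allIn-cong (λ a → cong S (inverseˡ π)) w)
    covering : ∀ w → covers (elements S′) (map (π ⟨$⟩ʳ_) w) ≡ covers (elements S) w
    covering w = ≡true-ext
      (λ e → Equivalence.from (covers-elements S w) λ z Sz →
        trans (sym (occurs-relabel π-injective z w))
              (Equivalence.to (covers-elements S′ _) e (π ⟨$⟩ʳ z) (trans (cong S (inverseˡ π)) Sz)))
      (λ e → Equivalence.from (covers-elements S′ _) λ z S′z →
        subst (λ z′ → occurs z′ (map (π ⟨$⟩ʳ_) w) ≡ true) (inverseʳ π)
              (trans (occurs-relabel π-injective (π ⟨$⟩ˡ z) w) (Equivalence.to (covers-elements S w) e (π ⟨$⟩ˡ z) S′z)))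
    target : ∀ w → (table (starProduct (π ⟨$⟩ʳ c) (map (π ⟨$⟩ʳ_) w)) =ᵀ conj v) ≡ (table (starProduct c w) =ᵀ v)
    target w = trans (cong (_=ᵀ conj v) (table-relabel c w))
                     (does-⇔ (mk⇔ conj-injective (cong conj)) (≡-dec _≟_ (conj (table (starProduct c w))) (conj v))
                                             (≡-dec _≟_ (table (starProduct c w)) v))

  transitiveCount-conj : ∀ c r v → transitiveCount (π ⟨$⟩ʳ c) r (conj v) ≡ transitiveCount c r v
  transitiveCount-conj c r v =
    trans (fullCount-cong (π ⟨$⟩ʳ c) allBut-relabel r (conj v)) (fullCount-relabel c (allBut c) r v)
    where
    allBut-relabel : ∀ a → allBut (π ⟨$⟩ʳ c) a ≡ allBut c (π ⟨$⟩ˡ a)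
    allBut-relabel a = cong not (trans (cong ((π ⟨$⟩ʳ c) ==_) (sym (inverseʳ π)))
                                       (==-relabel π-injective c (π ⟨$⟩ˡ a)))

  -- Conjugation invariance: relabel by π, then move the centre π c back to c.
  transitiveCount-class-function : ∀ c r v → transitiveCount c r (conj v) ≡ transitiveCount c r v
  transitiveCount-class-function c r v =
    trans (transitiveCount-centre c (π ⟨$⟩ʳ c) r (conj v)) (transitiveCount-conj c r v)

module _ {A : Set} {P : Pred A 0ℓ} (P? : Decidable P) where

  length-filter-++ : ∀ xs ys → length (filter P? (xs ++ ys)) ≡ length (filter P? xs) + length (filter P? ys)
  length-filter-++ []       ys = refl
  length-filter-++ (x ∷ xs) ys with does (P? x)
  ... | true  = cong suc (length-filter-++ xs ys)
  ... | false = length-filter-++ xs ys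

  length-filter-map : ∀ {B : Set} (f : B → A) ws → length (filter P? (List.map f ws)) ≡ length (filter (P? ∘ f) ws)
  length-filter-map f []       = refl
  length-filter-map f (w ∷ ws) with does (P? (f w))
  ... | true  = cong suc (length-filter-map f ws)
  ... | false = length-filter-map f ws

  length-filter-concat : ∀ {B : Set} n (g : Fin n → B) (F : B → List A) →
    length (filter P? (concatMap F (List.tabulate g))) ≡ ∑[ i < n ] length (filter P? (F (g i)))
  length-filter-concat zero    g F = refl
  length-filter-concat (suc n) g F =
    trans (length-filter-++ (F (g Fin.zero)) (concatMap F (List.tabulate (g ∘ Fin.suc))))
          (cong (length (filter P? (F (g Fin.zero))) +_) (length-filter-concat n (g ∘ Fin.suc) F))

allFinVec-count : ∀ m r {P : Pred (Vec (Fin m) r) 0ℓ} (P? : Decidable P) →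
                  length (filter P? (allFinVec m r)) ≡ ∑W r (λ is → ⟦ does (P? is) ⟧)
allFinVec-count m zero    P? with does (P? [])
... | true  = refl
... | false = refl
allFinVec-count m (suc r) P? =
  trans (length-filter-concat P? m (λ i → i) (λ i → List.map (i ∷_) (allFinVec m r)))
        (sum-cong-≗ λ i → trans (length-filter-map P? (i ∷_) (allFinVec m r))
                                (allFinVec-count m r (P? ∘ (i ∷_))))

∑W-inject : ∀ {m} r (G : Vec (Fin (suc m)) r → ℕ) →
            ∑W r (λ is → G (map inject₁ is)) ≡ ∑W r (λ w → guard (allIn (allBut (fromℕ m)) w) (G w))
∑W-inject     zero    G = refl
∑W-inject {m} (suc r) G = begin
  ∑[ i < m ] ∑W r (λ is → G (inject₁ i ∷ map inject₁ is))
    ≡⟨ sum-cong-≗ (λ i → trans (∑W-inject r (λ w → G (inject₁ i ∷ w))) (sym (inner-inject i))) ⟩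
  ∑[ i < m ] H (inject₁ i)
    ≡⟨ +-identityʳ _ ⟨
  ∑[ i < m ] H (inject₁ i) + 0
    ≡⟨ cong (∑[ i < m ] H (inject₁ i) +_) inner-last ⟨
  ∑[ i < m ] H (inject₁ i) + H (fromℕ m)
    ≡⟨ sum-init-last H ⟨
  ∑[ a < suc m ] H a ∎
  where
  H : Fin (suc m) → ℕ
  H a = ∑W r (λ w → guard (allIn (allBut (fromℕ m)) (a ∷ w)) (G (a ∷ w)))
  inner-inject : ∀ i → H (inject₁ i) ≡ ∑W r (λ w → guard (allIn (allBut (fromℕ m)) w) (G (inject₁ i ∷ w)))
  inner-inject i rewrite dec-false (fromℕ m ≟ inject₁ i) fromℕ≢inject₁ = refl
  inner-last : H (fromℕ m) ≡ 0
  inner-last rewrite dec-true (fromℕ m ≟ fromℕ m) refl = ∑W-guard r false (λ w → G (fromℕ m ∷ w))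

starProd-eq : ∀ {m r} (is : Vec (Fin m) r) x → starProd is ⟨$⟩ʳ x ≡ starProduct (fromℕ m) (map inject₁ is) x
starProd-eq     []       x = refl
starProd-eq {m} (i ∷ is) x = cong (transpose (inject₁ i) (fromℕ m)) (starProd-eq is x)

module _ {N : ℕ} where

  occurs-true : ∀ (q : Fin N) {r} (w : Vec (Fin N) r) → occurs q w ≡ true ⇔ q Vec.∈ w
  occurs-true q w = mk⇔ (to w) from
    where
    to : ∀ {r} (w : Vec (Fin N) r) → occurs q w ≡ true → q Vec.∈ w
    to (a ∷ w) e with q ≟ a
    ... | yes q≡a = here q≡a
    ... | no  _   = there (to w e)
    from : ∀ {r} {w : Vec (Fin N) r} → q Vec.∈ w → occurs q w ≡ true
    from (here refl) rewrite dec-true (q ≟ q) refl = refl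
    from {w = a ∷ w} (there q∈w) = trans (cong ((q == a) ∨_) (from q∈w)) (∨-zeroʳ (q == a))

  table-≡⇔ : ∀ (f g : Fin N → Fin N) → table f ≡ table g ⇔ (∀ x → f x ≡ g x)
  table-≡⇔ f g = mk⇔
    (λ e x → trans (sym (lookup∘tabulate f x)) (trans (cong (λ t → lookup t x) e) (lookup∘tabulate g x)))
    tabulate-cong

  allBut-≢ : ∀ {c z : Fin N} → c ≢ z → allBut c z ≡ true
  allBut-≢ {c} {z} c≢z = cong not (dec-false (c ≟ z) c≢z)

  allBut-true : ∀ {c z : Fin N} → allBut c z ≡ true → c ≢ z
  allBut-true {c} e refl with trans (sym e) (cong not (dec-true (c ≟ c) refl))
  ... | ()

transitive-iff : ∀ {m r} (is : Vec (Fin m) r) →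
                 (∀ i → i Vec.∈ is) ⇔ (covers (elements (allBut (fromℕ m))) (map inject₁ is) ≡ true)
transitive-iff {m} is = mk⇔
  (λ all∈ → Equivalence.from (covers-elements (allBut (fromℕ m)) (map inject₁ is)) λ z last≢z →
    let m≢z : m ≢ toℕ z
        m≢z m≡z = allBut-true last≢z (toℕ-injective (trans (toℕ-fromℕ m) m≡z))
        j = lower₁ z m≢z
    in subst (λ z′ → occurs z′ (map inject₁ is) ≡ true) (inject₁-lower₁ z m≢z)
             (trans (occurs-relabel inject₁-injective j is) (Equivalence.from (occurs-true j is) (all∈ j))))
  (λ covered i → Equivalence.to (occurs-true i is)
    (trans (sym (occurs-relabel inject₁-injective i is))
           (Equivalence.to (covers-elements (allBut (fromℕ m)) (map inject₁ is)) covered (inject₁ i) (allBut-≢ (fromℕ≢inject₁ {i = i})))))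

isTSF-indicator : ∀ {m r} (σ : Permutation′ (suc m)) (is : Vec (Fin m) r) →
  does (isTSF? σ is) ≡ covers (elements (allBut (fromℕ m))) (map inject₁ is) ∧
                       (table (starProduct (fromℕ m) (map inject₁ is)) =ᵀ table (σ ⟨$⟩ʳ_))
isTSF-indicator {m} σ is = trans (cong₂ _∧_ factorization transitive)
  (∧-comm (table (starProduct (fromℕ m) (map inject₁ is)) =ᵀ table (σ ⟨$⟩ʳ_))
          (covers (elements (allBut (fromℕ m))) (map inject₁ is)))
  where
  factorization : does (all? (λ x → starProd is ⟨$⟩ʳ x ≟ σ ⟨$⟩ʳ x)) ≡
                  (table (starProduct (fromℕ m) (map inject₁ is)) =ᵀ table (σ ⟨$⟩ʳ_))
  factorization = does-⇔ (mk⇔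
    (λ agree → tabulate-cong (λ x → trans (sym (starProd-eq is x)) (agree x)))
    (λ eq x → trans (starProd-eq is x)
                     (Equivalence.to (table-≡⇔ (starProduct (fromℕ m) (map inject₁ is)) (σ ⟨$⟩ʳ_)) eq x)))
    (all? (λ x → starProd is ⟨$⟩ʳ x ≟ σ ⟨$⟩ʳ x))
    (≡-dec _≟_ (table (starProduct (fromℕ m) (map inject₁ is))) (table (σ ⟨$⟩ʳ_)))
  transitive : does (all? (λ i → VecDec._∈?_ _≟_ i is)) ≡ covers (elements (allBut (fromℕ m))) (map inject₁ is)
  transitive = does-bool (all? (λ i → VecDec._∈?_ _≟_ i is)) (transitive-iff is)

numTSF-as-transitiveCount : ∀ m r (σ : Permutation′ (suc m)) →
                            numTSF m r σ ≡ transitiveCount (fromℕ m) r (table (σ ⟨$⟩ʳ_))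
numTSF-as-transitiveCount m r σ = begin
  length (filter (isTSF? σ) (allFinVec m r))
    ≡⟨ allFinVec-count m r (isTSF? σ) ⟩
  ∑W r (λ is → ⟦ does (isTSF? σ is) ⟧)
    ≡⟨ ∑W-cong r (λ is → cong ⟦_⟧ (isTSF-indicator σ is)) ⟩
  ∑W r (λ is → ⟦ covered (map inject₁ is) ⟧)
    ≡⟨ ∑W-inject r (λ w → ⟦ covered w ⟧) ⟩
  ∑W r (λ w → guard (allIn (allBut (fromℕ m)) w) ⟦ covered w ⟧)
    ≡⟨ ∑W-cong r (λ w → guard-indicator (allIn (allBut (fromℕ m)) w) (covered w)) ⟩
  transitiveCount (fromℕ m) r (table (σ ⟨$⟩ʳ_)) ∎
  where
  covered : Vec (Fin (suc m)) r → Bool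
  covered w = covers (elements (allBut (fromℕ m))) w ∧ (table (starProduct (fromℕ m) w) =ᵀ table (σ ⟨$⟩ʳ_))

-- The theorem: numTSF is a class function.
proposition1 : (m r : ℕ) → 1 ≤ m → (σ τ : Permutation′ (suc m)) →
               Conjugate σ τ → numTSF m r σ ≡ numTSF m r τ
proposition1 m r _ σ τ (π , τ≡πσπ⁻¹) = begin
  numTSF m r σ
    ≡⟨ numTSF-as-transitiveCount m r σ ⟩
  transitiveCount (fromℕ m) r (table (σ ⟨$⟩ʳ_))
    ≡⟨ transitiveCount-class-function π (fromℕ m) r (table (σ ⟨$⟩ʳ_)) ⟨
  transitiveCount (fromℕ m) r (conj π (table (σ ⟨$⟩ʳ_)))
    ≡⟨ cong (transitiveCount (fromℕ m) r) conj-σ≡τ ⟩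
  transitiveCount (fromℕ m) r (table (τ ⟨$⟩ʳ_))
    ≡⟨ numTSF-as-transitiveCount m r τ ⟨
  numTSF m r τ ∎
  where
  conj-σ≡τ : conj π (table (σ ⟨$⟩ʳ_)) ≡ table (τ ⟨$⟩ʳ_)
  conj-σ≡τ = tabulate-cong λ x →
    trans (cong (π ⟨$⟩ʳ_) (lookup∘tabulate (σ ⟨$⟩ʳ_) (π ⟨$⟩ˡ x))) (sym (τ≡πσπ⁻¹ x))
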